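{- For each integer $d\ge 2$, let $f(d)$ be the least integer such that for every $n\ge f(d)$ the digraph $D_{n,d}$ is the unique (up to isomorphism) digraph of largest Wiener index among all digraphs of order $n$ and diameter $d$. Then $f(d)=d+\Omega(\sqrt d)$; that is, there exist constants $c>0$ and $d_0$ such that $f(d)\ge d+c\sqrt d$ for all $d\ge d_0$.
   Context: Digraphs are finite, without loops or multiple arcs (arcs in both directions allowed). $d(u,v)$ is the length of a shortest directed path from $u$ to $v$; the diameter is the maximum of $d(u,v)$ over all ordered pairs; the Wiener index is $W(D)=\sum d(u,v)$ over all ordered pairs of distinct vertices. For $n>d$, $D_{n,d}$ is the digraph with vertices $u_1,\dots,u_{d-1},\ell_1,\dots,\ell_{n-d+1}$ and arcs $u_i\to u_{i+1}$ ($1\le i\le d-2$), $u_{d-1}\to\ell_j$ and $\ell_j\to u_1$ ($1\le j\le n-d+1$); it has order $n$ and diameter $d$. It is known that for every $d\ge2$ there exists some $N$ such that for all $n\ge N$, $D_{n,d}$ is the unique digraph of maximum Wiener index among digraphs of order $n$ and diameter $d$, so $f(d)$ is well defined. -}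

module Defs where

open import Data.Nat using (ℕ; zero; suc; _+_; _*_; _∸_; _≤_; _<_)
open import Data.Nat.Properties using () renaming (_≟_ to _≟ℕ_; _≤?_ to _≤?ℕ_)
open import Data.Fin using (Fin; toℕ) renaming (zero to fzero; suc to fsuc)
open import Data.Fin.Properties using () renaming (_≟_ to _≟F_)
open import Data.Bool using (Bool; true; false; _∧_; _∨_; not; if_then_else_; T)
open import Data.Product using (Σ; _×_; _,_; ∃-syntax)
open import Relation.Nullary using (does)
open import Relation.Binary.PropositionalEquality using (_≡_; refl)
open import Function.Bundles using (_↔_; Inverse)

record Digraph (n : ℕ) : Set where
  field
    adj      : Fin n → Fin n → Bool
    loopless : ∀ i → adj i i ≡ false
open Digraph public

anyFin : ∀ {n} → (Fin n → Bool) → Bool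
anyFin {zero}  p = false
anyFin {suc n} p = p fzero ∨ anyFin (λ i → p (fsuc i))

reach : ∀ {n} → Digraph n → ℕ → Fin n → Fin n → Bool
reach G zero    u v = does (u ≟F v)
reach G (suc k) u v = reach G k u v ∨ anyFin (λ w → reach G k u w ∧ adj G w v)

search : (ℕ → Bool) → ℕ → ℕ
search p zero    = zero
search p (suc b) = if p zero then zero else suc (search (λ k → p (suc k)) b)

-- d(u,v): length of a shortest directed u–v path (a shortest walk is a path and has
-- length < n); for unreachable v the value is n (never used for strongly connected G).
dist : ∀ {n} → Digraph n → Fin n → Fin n → ℕ
dist {n} G u v = search (λ k → reach G k u v) n

sumFin : ∀ {n} → (Fin n → ℕ) → ℕ
sumFin {zero}  f = zero
sumFin {suc n} f = f fzero + sumFin (λ i → f (fsuc i))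

W : ∀ {n} → Digraph n → ℕ
W G = sumFin (λ u → sumFin (λ v → if does (u ≟F v) then 0 else dist G u v))

-- G has diameter d: every v is reachable from every u by a walk of length ≤ d
-- (so all distances are defined and ≤ d), and some ordered pair is at distance exactly d.
Diameter : ∀ {n} → Digraph n → ℕ → Set
Diameter G d = (∀ u v → T (reach G d u v)) × (∃[ u ] ∃[ v ] dist G u v ≡ d)

_≅_ : ∀ {n} → Digraph n → Digraph n → Set
_≅_ {n} G H = Σ (Fin n ↔ Fin n) λ σ →
  ∀ i j → adj G i j ≡ adj H (Inverse.to σ i) (Inverse.to σ j)

-- turn a Boolean relation into a loopless digraph by removing the diagonal
-- (used only for D n d, whose arc relation has no loops anyway when d ≥ 2)
mask : ∀ {n} → (Fin n → Fin n → Bool) → Digraph n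
mask {n} r = record { adj = a ; loopless = lp }
  where
  a : Fin n → Fin n → Bool
  a i j = not (does (i ≟F j)) ∧ r i j
  lp : ∀ i → a i i ≡ false
  lp i with i ≟F i
  ... | Relation.Nullary.yes _ = refl
  ... | Relation.Nullary.no ¬p with ¬p refl
  ... | ()

-- D_{n,d}: vertex index k ≤ d-2 is u_{k+1}, indices k ≥ d-1 are the ℓ_j.
-- Arcs: u_i → u_{i+1}; u_{d-1} → ℓ_j; ℓ_j → u_1.
Dnd : (n d : ℕ) → Digraph n
Dnd n d = mask λ i j →
     (does (toℕ j ≟ℕ suc (toℕ i)) ∧ does (toℕ j ≤?ℕ (d ∸ 2)))
   ∨ (does (toℕ i ≟ℕ (d ∸ 2)) ∧ does ((d ∸ 1) ≤?ℕ toℕ j))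
   ∨ (does ((d ∸ 1) ≤?ℕ toℕ i) ∧ does (toℕ j ≟ℕ 0))

UniqueMax : ℕ → ℕ → Set
UniqueMax n d = (d < n) × (Diameter (Dnd n d) d) ×
  (∀ (G : Digraph n) → Diameter G d →
     (W G ≤ W (Dnd n d)) × (W G ≡ W (Dnd n d) → G ≅ Dnd n d))

-- Let k = n − d ≥ 1. D_{n,d} lies over the directed d-cycle with k + 1 independent vertices
-- over one point. Compare it with the digraph G obtained from the directed (d + 1)-cycle by
-- replacing one point with a complete digraph on k vertices; G also has order n and diameter d.
-- In both, vertices over different points are at the cyclic distance of those points, and in
-- D_{n,d} two vertices over the same point are at distance at most d. Summing over pairs,
-- W(G) ≥ (d + 2k − 1) d(d + 1)/2 and W(D_{n,d}) ≤ (d + 2k) d(d − 1)/2 + (k + 1)² d, so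
-- W(G) − W(D_{n,d}) ≥ d (d − 2k² − 3)/2. Maximality of D_{n,d} thus forces d ≤ 2k² + 3 ≤ 9k².
module Submission where

open import Data.Bool using (Bool; true; false; if_then_else_; T; _∧_)
open import Data.Bool.Properties using (T-∨; T-∧)
open import Data.Empty using (⊥-elim)
open import Data.Fin using (Fin; toℕ; fromℕ<) renaming (zero to fzero; suc to fsuc)
open import Data.Fin.Properties using (toℕ-injective; toℕ-fromℕ<) renaming (_≟_ to _≟F_)
open import Data.Nat using (ℕ; zero; suc; _+_; _*_; _∸_; _≤_; _<_; z≤n; s≤s; _≤′_; ≤′-refl; ≤′-step)
open import Data.Nat.Properties
open import Data.Nat.Solver using (module +-*-Solver)
open import Algebra.Properties.CommutativeSemigroup +-commutativeSemigroup using () renaming (interchange to +-interchange)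
open import Data.Product using (_×_; _,_; proj₁; proj₂; ∃-syntax)
open import Data.Sum using (_⊎_; inj₁; inj₂; map₂)
open import Data.Unit using (tt)
open import Function using (_∘_; const)
open import Function.Bundles using (module Equivalence)
open import Relation.Binary.PropositionalEquality
open import Relation.Nullary using (Dec; does; yes; no; ¬_; contradiction)
open import Relation.Nullary.Decidable using (dec-true; dec-false; _×-dec_; _⊎-dec_)

open import Defs
open +-*-Solver

-- Finite sums

∑ : ℕ → (ℕ → ℕ) → ℕ
∑ zero    g = 0
∑ (suc n) g = g 0 + ∑ n (g ∘ suc)

∑-cong : ∀ n {f g : ℕ → ℕ} → (∀ {i} → i < n → f i ≡ g i) → ∑ n f ≡ ∑ n g
∑-cong zero    f≗g = refl
∑-cong (suc n) f≗g = cong₂ _+_ (f≗g (s≤s z≤n)) (∑-cong n (f≗g ∘ s≤s))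

∑-const : ∀ n c → ∑ n (const c) ≡ n * c
∑-const zero    c = refl
∑-const (suc n) c = cong (c +_) (∑-const n c)

∑-distrib-+ : ∀ n (f g : ℕ → ℕ) → ∑ n (λ i → f i + g i) ≡ ∑ n f + ∑ n g
∑-distrib-+ zero    f g = refl
∑-distrib-+ (suc n) f g = begin
  (f 0 + g 0) + ∑ n (λ i → f (suc i) + g (suc i)) ≡⟨ cong ((f 0 + g 0) +_) (∑-distrib-+ n (f ∘ suc) (g ∘ suc)) ⟩
  (f 0 + g 0) + (∑ n (f ∘ suc) + ∑ n (g ∘ suc))   ≡⟨ +-interchange (f 0) (g 0) (∑ n (f ∘ suc)) (∑ n (g ∘ suc)) ⟩
  (f 0 + ∑ n (f ∘ suc)) + (g 0 + ∑ n (g ∘ suc))   ∎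
  where open ≡-Reasoning

*-distribˡ-∑ : ∀ n c (f : ℕ → ℕ) → ∑ n (λ i → c * f i) ≡ c * ∑ n f
*-distribˡ-∑ zero    c f = sym (*-zeroʳ c)
*-distribˡ-∑ (suc n) c f =
  trans (cong (c * f 0 +_) (*-distribˡ-∑ n c (f ∘ suc))) (sym (*-distribˡ-+ c (f 0) _))

∑-split : ∀ m n (g : ℕ → ℕ) → ∑ (m + n) g ≡ ∑ m g + ∑ n (λ i → g (m + i))
∑-split zero    n g = refl
∑-split (suc m) n g = trans (cong (g 0 +_) (∑-split m n (g ∘ suc))) (sym (+-assoc (g 0) _ _))

∑-id : ∀ n → 2 * ∑ n (λ i → i) + n ≡ n * n
∑-id zero    = refl
∑-id (suc n) = begin
  2 * (0 + ∑ n suc) + suc n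
    ≡⟨ cong (λ s → 2 * s + suc n) (∑-distrib-+ n (const 1) (λ i → i)) ⟩
  2 * (∑ n (const 1) + S) + suc n
    ≡⟨ cong (λ s → 2 * (s + S) + suc n) (∑-const n 1) ⟩
  2 * (n * 1 + S) + suc n
    ≡⟨ solve 2 (λ n s → con 2 :* (n :* con 1 :+ s) :+ (con 1 :+ n) := (con 2 :* s :+ n) :+ (con 2 :* n :+ con 1)) refl n S ⟩
  (2 * S + n) + (2 * n + 1)
    ≡⟨ cong (_+ (2 * n + 1)) (∑-id n) ⟩
  n * n + (2 * n + 1)
    ≡⟨ solve 1 (λ n → n :* n :+ (con 2 :* n :+ con 1) := (con 1 :+ n) :* (con 1 :+ n)) refl n ⟩
  suc n * suc n ∎
  where
  open ≡-Reasoning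
  S : ℕ
  S = ∑ n (λ i → i)

∑²-distrib-+ : ∀ n (f g : ℕ → ℕ → ℕ) →
  ∑ n (λ a → ∑ n (λ b → f a b + g a b)) ≡ ∑ n (λ a → ∑ n (f a)) + ∑ n (λ a → ∑ n (g a))
∑²-distrib-+ n f g = trans (∑-cong n (λ {a} _ → ∑-distrib-+ n (f a) (g a)))
                           (∑-distrib-+ n (λ a → ∑ n (f a)) (λ a → ∑ n (g a)))

sumFin≡∑ : ∀ {n} (f : Fin n → ℕ) (g : ℕ → ℕ) → (∀ i → f i ≡ g (toℕ i)) → sumFin f ≡ ∑ n g
sumFin≡∑ {zero}  f g f≗g = refl
sumFin≡∑ {suc n} f g f≗g = cong₂ _+_ (f≗g fzero) (sumFin≡∑ (f ∘ fsuc) (g ∘ suc) (f≗g ∘ fsuc))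

sumFin-mono-≤ : ∀ {n} {f g : Fin n → ℕ} → (∀ i → f i ≤ g i) → sumFin f ≤ sumFin g
sumFin-mono-≤ {zero}  f≤g = z≤n
sumFin-mono-≤ {suc n} f≤g = +-mono-≤ (f≤g fzero) (sumFin-mono-≤ (f≤g ∘ fsuc))

-- The directed cycle

cycDist : ℕ → ℕ → ℕ → ℕ
cycDist L p q = if does (q <? p) then L + q ∸ p else q ∸ p

cycSucc : ℕ → ℕ → ℕ
cycSucc L p = if does (suc p <? L) then suc p else 0

cycPred : ℕ → ℕ → ℕ
cycPred L zero    = L ∸ 1
cycPred L (suc q) = q

module _ {L : ℕ} where

  cycDist-≤ : ∀ {p q} → p ≤ q → cycDist L p q ≡ q ∸ p
  cycDist-≤ {p} {q} p≤q rewrite dec-false (q <? p) (≤⇒≯ p≤q) = refl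

  cycDist-> : ∀ {p q} → q < p → cycDist L p q ≡ L + q ∸ p
  cycDist-> {p} {q} q<p rewrite dec-true (q <? p) q<p = refl

  cycDist-self : ∀ p → cycDist L p p ≡ 0
  cycDist-self p = trans (cycDist-≤ {p} ≤-refl) (n∸n≡0 p)

  cycDist≡0⇒≡ : ∀ {p q} → p < L → cycDist L p q ≡ 0 → p ≡ q
  cycDist≡0⇒≡ {p} {q} p<L eq with ≤-<-connex p q
  ... | inj₁ p≤q = ≤-antisym p≤q (m∸n≡0⇒m≤n (trans (sym (cycDist-≤ p≤q)) eq))
  ... | inj₂ q<p = contradiction (m∸n≡0⇒m≤n (trans (sym (cycDist-> q<p)) eq))
                                 (<⇒≱ (<-≤-trans p<L (m≤m+n L q)))

  cycDist<L : ∀ {p q} → p < L → q < L → cycDist L p q < L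
  cycDist<L {p} {q} p<L q<L with ≤-<-connex p q
  ... | inj₁ p≤q rewrite cycDist-≤ p≤q = ≤-<-trans (m∸n≤m q p) q<L
  ... | inj₂ q<p rewrite cycDist-> q<p = +-cancelʳ-< p _ L (begin-strict
    L + q ∸ p + p ≡⟨ m∸n+n≡m (≤-trans (<⇒≤ p<L) (m≤m+n L q)) ⟩
    L + q         <⟨ +-monoʳ-< L q<p ⟩
    L + p         ∎)
    where open ≤-Reasoning

  cycDist-suc : ∀ {p q} → p < L → suc q ≢ p → cycDist L p (suc q) ≡ suc (cycDist L p q)
  cycDist-suc {p} {q} p<L 1+q≢p with ≤-<-connex p q
  ... | inj₁ p≤q rewrite cycDist-≤ p≤q | cycDist-≤ (m≤n⇒m≤1+n p≤q) = +-∸-assoc 1 p≤q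
  ... | inj₂ q<p rewrite cycDist-> q<p | cycDist-> (≤∧≢⇒< q<p 1+q≢p) | +-suc L q =
    +-∸-assoc 1 (≤-trans (<⇒≤ p<L) (m≤m+n L q))

cycDist-wrap : ∀ {L p} → 0 < p → p < suc L → cycDist (suc L) p 0 ≡ suc (cycDist (suc L) p L)
cycDist-wrap {L} {p} 0<p (s≤s p≤L) rewrite cycDist-> {suc L} 0<p | cycDist-≤ {suc L} p≤L | +-identityʳ L = +-∸-assoc 1 p≤L

module _ {L : ℕ} where

  cycSucc-< : ∀ {p} → suc p < L → cycSucc L p ≡ suc p
  cycSucc-< {p} 1+p<L rewrite dec-true (suc p <? L) 1+p<L = refl

  cycSucc-≮ : ∀ {p} → ¬ suc p < L → cycSucc L p ≡ 0
  cycSucc-≮ {p} 1+p≮L rewrite dec-false (suc p <? L) 1+p≮L = refl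

  cycSucc≢ : 2 ≤ L → ∀ p → cycSucc L p ≢ p
  cycSucc≢ 2≤L zero    rewrite cycSucc-< 2≤L = λ ()
  cycSucc≢ 2≤L (suc p) with suc (suc p) <? L
  ... | yes 2+p<L rewrite cycSucc-< 2+p<L = 1+n≢n
  ... | no  2+p≮L rewrite cycSucc-≮ 2+p≮L = λ ()

  cycPred<L : ∀ {q} → q < L → cycPred L q < L
  cycPred<L {zero}  (s≤s _) = ≤-refl
  cycPred<L {suc q} 1+q<L   = <-trans (n<1+n q) 1+q<L

  cycSucc-cycPred : ∀ {q} → q < L → cycSucc L (cycPred L q) ≡ q
  cycSucc-cycPred {zero}  (s≤s _) = cycSucc-≮ (<-irrefl refl)
  cycSucc-cycPred {suc q} 1+q<L   = cycSucc-< 1+q<L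

cycDist-cycSucc : ∀ {L p q} → p < L → q < L → cycDist L p (cycSucc L q) ≤ suc (cycDist L p q)
cycDist-cycSucc {L} {p} {q} p<L q<L with suc q <? L
... | yes 1+q<L rewrite cycSucc-< 1+q<L with suc q ≟ p
...   | yes refl   = ≤-trans (≤-reflexive (cycDist-self {L} (suc q))) z≤n
...   | no 1+q≢p   = ≤-reflexive (cycDist-suc p<L 1+q≢p)
cycDist-cycSucc {L} {zero}  {q} p<L q<L | no 1+q≮L rewrite cycSucc-≮ 1+q≮L = z≤n
cycDist-cycSucc {suc L} {suc p} {q} p<L (s≤s q≤L) | no 1+q≮L
  rewrite cycSucc-≮ 1+q≮L | ≤-antisym q≤L (≤-pred (≮⇒≥ 1+q≮L)) = ≤-reflexive (cycDist-wrap (s≤s z≤n) p<L)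

cycDist-cycPred : ∀ {L p q m} → p < L → q < L → cycDist L p q ≡ suc m → cycDist L p (cycPred L q) ≡ m
cycDist-cycPred {L} {p} {suc q} p<L _ eq with suc q ≟ p
... | yes refl    = contradiction (trans (sym (cycDist-self {L} (suc q))) eq) (λ ())
... | no 1+q≢p    = suc-injective (trans (sym (cycDist-suc p<L 1+q≢p)) eq)
cycDist-cycPred {suc L} {suc p} {zero} p<L _ eq = suc-injective (trans (sym (cycDist-wrap (s≤s z≤n) p<L)) eq)
cycDist-cycPred {p = zero} {zero} _ _ ()

cycDist≡1⇒cycSucc : ∀ {L p q} → p < L → q < L → cycDist L p q ≡ 1 → q ≡ cycSucc L p
cycDist≡1⇒cycSucc {L} {p} {q} p<L q<L eq = begin
  q                        ≡⟨ sym (cycSucc-cycPred q<L) ⟩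
  cycSucc L (cycPred L q)  ≡⟨ cong (cycSucc L) (sym (cycDist≡0⇒≡ p<L (cycDist-cycPred p<L q<L eq))) ⟩
  cycSucc L p              ∎
  where open ≡-Reasoning

cycDist-rowSum : ∀ {L p} → p < L → 2 * ∑ L (cycDist L p) + L ≡ L * L
cycDist-rowSum {L} {p} p<L with m≤n⇒∃[o]m+o≡n (<⇒≤ p<L)
... | r , refl = begin
  2 * ∑ (p + r) (cycDist L p) + (p + r)
    ≡⟨ cong (λ s → 2 * s + (p + r)) (∑-split p r (cycDist L p)) ⟩
  2 * (∑ p (cycDist L p) + ∑ r (λ i → cycDist L p (p + i))) + (p + r)
    ≡⟨ cong₂ (λ s t → 2 * (s + t) + (p + r)) (∑-cong p before) (∑-cong r after) ⟩
  2 * (∑ p (λ i → r + i) + ∑ r (λ i → i)) + (p + r)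
    ≡⟨ cong (λ s → 2 * (s + ∑ r (λ i → i)) + (p + r))
            (trans (∑-distrib-+ p (const r) (λ i → i)) (cong (_+ ∑ p (λ i → i)) (∑-const p r))) ⟩
  2 * ((p * r + ∑ p (λ i → i)) + ∑ r (λ i → i)) + (p + r)
    ≡⟨ solve 4 (λ p r s t → con 2 :* ((p :* r :+ s) :+ t) :+ (p :+ r)
                           := con 2 :* p :* r :+ (con 2 :* s :+ p) :+ (con 2 :* t :+ r)) refl p r _ _ ⟩
  2 * p * r + (2 * ∑ p (λ i → i) + p) + (2 * ∑ r (λ i → i) + r)
    ≡⟨ cong₂ (λ s t → 2 * p * r + s + t) (∑-id p) (∑-id r) ⟩
  2 * p * r + p * p + r * r
    ≡⟨ solve 2 (λ p r → con 2 :* p :* r :+ p :* p :+ r :* r := (p :+ r) :* (p :+ r)) refl p r ⟩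
  (p + r) * (p + r) ∎
  where
  open ≡-Reasoning
  before : ∀ {i} → i < p → cycDist (p + r) p i ≡ r + i
  before {i} i<p = trans (cycDist-> {p + r} i<p) (trans (cong (_∸ p) (+-assoc p r i)) (m+n∸m≡n p (r + i)))
  after : ∀ {i} → i < r → cycDist (p + r) p (p + i) ≡ i
  after {i} _ = trans (cycDist-≤ {p + r} (m≤m+n p i)) (m+n∸m≡n p i)

cycRow : ℕ → ℕ
cycRow L = ∑ L (cycDist L 0)

∑-cycDist-row : ∀ {L p} → p < L → ∑ L (cycDist L p) ≡ cycRow L
∑-cycDist-row {L} p<L = *-cancelˡ-≡ _ _ 2
  (+-cancelʳ-≡ L _ _ (trans (cycDist-rowSum p<L) (sym (cycDist-rowSum (≤-<-trans z≤n p<L)))))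

cycRow-double : ∀ l → 2 * cycRow (suc l) ≡ l * suc l
cycRow-double l = +-cancelʳ-≡ (suc l) _ _ (trans (cycDist-rowSum {suc l} {0} (s≤s z≤n)) (+-comm (suc l) (l * suc l)))

cycDist-+-cycDist-0 : ∀ {L p} → 0 < p → p < L → cycDist L p 0 + cycDist L 0 p ≡ L
cycDist-+-cycDist-0 {L} {p} 0<p p<L rewrite cycDist-> {L} 0<p | cycDist-≤ {L} {0} {p} z≤n | +-identityʳ L =
  m∸n+n≡m (<⇒≤ p<L)

∑-cycDist-column : ∀ l → ∑ (suc l) (λ p → cycDist (suc l) p 0) ≡ cycRow (suc l)
∑-cycDist-column l = cong (cycDist L 0 0 +_) (+-cancelʳ-≡ Y X Y (trans X+Y≡l*L (sym Y+Y≡l*L)))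
  where
  L X Y : ℕ
  L = suc l
  X = ∑ l (λ i → cycDist L (suc i) 0)
  Y = ∑ l (λ i → cycDist L 0 (suc i))
  X+Y≡l*L : X + Y ≡ l * L
  X+Y≡l*L = begin
    X + Y                                            ≡⟨ sym (∑-distrib-+ l _ _) ⟩
    ∑ l (λ i → cycDist L (suc i) 0 + cycDist L 0 (suc i)) ≡⟨ ∑-cong l (λ i<l → cycDist-+-cycDist-0 (s≤s z≤n) (s≤s i<l)) ⟩
    ∑ l (const L)                                    ≡⟨ ∑-const l L ⟩
    l * L                                            ∎
    where open ≡-Reasoning
  Y+Y≡l*L : Y + Y ≡ l * L
  Y+Y≡l*L = trans (cong (Y +_) (sym (+-identityʳ Y))) (cycRow-double l)

-- Vertex a < l lies over the point a + 1 of the cycle and all other vertices over 0;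
-- for D_{n,d} (l = d − 1) these are u_{a+1} and the ℓ_j.
position : ℕ → ℕ → ℕ
position l a = if does (a <? l) then suc a else 0

module _ (l : ℕ) where

  position-< : ∀ {a} → a < l → position l a ≡ suc a
  position-< {a} a<l rewrite dec-true (a <? l) a<l = refl

  position-≥ : ∀ {a} → l ≤ a → position l a ≡ 0
  position-≥ {a} l≤a rewrite dec-false (a <? l) (≤⇒≯ l≤a) = refl

  position<1+l : ∀ a → position l a < suc l
  position<1+l a with a <? l
  ... | yes a<l rewrite position-< a<l = s≤s a<l
  ... | no  a≮l rewrite position-≥ (≮⇒≥ a≮l) = s≤s z≤n

  position≡suc⇒≡ : ∀ {a x} → position l a ≡ suc x → a ≡ x
  position≡suc⇒≡ {a} eq with a <? l
  ... | yes a<l = suc-injective (trans (sym (position-< a<l)) eq)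
  ... | no  a≮l = contradiction (trans (sym (position-≥ (≮⇒≥ a≮l))) eq) (λ ())

  position≡0⇒≥ : ∀ {a} → position l a ≡ 0 → l ≤ a
  position≡0⇒≥ {a} eq with a <? l
  ... | yes a<l = contradiction (trans (sym (position-< a<l)) eq) (λ ())
  ... | no  a≮l = ≮⇒≥ a≮l

  position-injective : ∀ {a b} → position l a ≡ position l b → position l a ≡ 0 ⊎ a ≡ b
  position-injective {a} {b} eq with position l a in pa
  ... | zero  = inj₁ refl
  ... | suc x = inj₂ (trans (position≡suc⇒≡ pa) (sym (position≡suc⇒≡ (sym eq))))

∑-position : ∀ l m (g : ℕ → ℕ) → ∑ (l + suc m) (g ∘ position l) ≡ ∑ (suc l) g + m * g 0
∑-position l m g = begin
  ∑ (l + suc m) (g ∘ position l)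
    ≡⟨ ∑-split l (suc m) (g ∘ position l) ⟩
  ∑ l (g ∘ position l) + ∑ (suc m) (λ i → g (position l (l + i)))
    ≡⟨ cong₂ _+_ (∑-cong l (cong g ∘ position-< l)) (∑-cong (suc m) (λ {i} _ → cong g (position-≥ l (m≤m+n l i)))) ⟩
  ∑ l (g ∘ suc) + ∑ (suc m) (const (g 0))
    ≡⟨ cong (∑ l (g ∘ suc) +_) (∑-const (suc m) (g 0)) ⟩
  ∑ l (g ∘ suc) + (g 0 + m * g 0)
    ≡⟨ sym (+-assoc (∑ l (g ∘ suc)) (g 0) _) ⟩
  (∑ l (g ∘ suc) + g 0) + m * g 0
    ≡⟨ cong (_+ m * g 0) (+-comm (∑ l (g ∘ suc)) (g 0)) ⟩
  ∑ (suc l) g + m * g 0 ∎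
  where open ≡-Reasoning

∑²-position-cycDist : ∀ l m →
  ∑ (l + suc m) (λ a → ∑ (l + suc m) (λ b → cycDist (suc l) (position l a) (position l b)))
    ≡ (suc l + 2 * m) * cycRow (suc l)
∑²-position-cycDist l m = begin
  ∑ n (λ a → ∑ n (λ b → cycDist L (position l a) (position l b)))
    ≡⟨ ∑-cong n (λ {a} _ → ∑-position l m (cycDist L (position l a))) ⟩
  ∑ n (F ∘ position l)
    ≡⟨ ∑-position l m F ⟩
  ∑ L F + m * F 0
    ≡⟨ cong₂ (λ s t → s + m * t) (∑-cong L F-row) (F-row {0} (s≤s z≤n)) ⟩
  ∑ L (λ p → R + m * cycDist L p 0) + m * (R + m * 0)
    ≡⟨ cong (_+ m * (R + m * 0)) (∑-distrib-+ L (const R) (λ p → m * cycDist L p 0)) ⟩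
  (∑ L (const R) + ∑ L (λ p → m * cycDist L p 0)) + m * (R + m * 0)
    ≡⟨ cong₂ (λ s t → (s + t) + m * (R + m * 0)) (∑-const L R)
             (trans (*-distribˡ-∑ L m (λ p → cycDist L p 0)) (cong (m *_) (∑-cycDist-column l))) ⟩
  (L * R + m * R) + m * (R + m * 0)
    ≡⟨ solve 3 (λ l m r → ((con 1 :+ l) :* r :+ m :* r) :+ m :* (r :+ m :* con 0)
                         := ((con 1 :+ l) :+ con 2 :* m) :* r) refl l m R ⟩
  (L + 2 * m) * R ∎
  where
  open ≡-Reasoning
  L n R : ℕ
  L = suc l
  n = l + suc m
  R = cycRow L
  F : ℕ → ℕ
  F p = ∑ L (cycDist L p) + m * cycDist L p 0
  F-row : ∀ {p} → p < L → F p ≡ R + m * cycDist L p 0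
  F-row {p} p<L = cong (_+ m * cycDist L p 0) (∑-cycDist-row p<L)

δ₀ : ℕ → ℕ
δ₀ zero    = 1
δ₀ (suc _) = 0

∑-position-δ₀ : ∀ l m x → ∑ (l + suc m) (λ a → δ₀ (position l a) * x) ≡ suc m * x
∑-position-δ₀ l m x = begin
  ∑ (l + suc m) (λ a → δ₀ (position l a) * x) ≡⟨ ∑-position l m (λ q → δ₀ q * x) ⟩
  (1 * x + ∑ l (const 0)) + m * (1 * x)        ≡⟨ cong (λ s → (1 * x + s) + m * (1 * x)) (∑-const l 0) ⟩
  (1 * x + l * 0) + m * (1 * x)                ≡⟨ solve 3 (λ x l m → (con 1 :* x :+ l :* con 0) :+ m :* (con 1 :* x)
                                                               := (con 1 :+ m) :* x) refl x l m ⟩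
  suc m * x                                    ∎
  where open ≡-Reasoning

∑²-position-δ₀ : ∀ l m x →
  ∑ (l + suc m) (λ a → ∑ (l + suc m) (λ b → δ₀ (position l a) * (δ₀ (position l b) * x)))
    ≡ suc m * (suc m * x)
∑²-position-δ₀ l m x = begin
  ∑ n (λ a → ∑ n (λ b → δ₀ (position l a) * (δ₀ (position l b) * x)))
    ≡⟨ ∑-cong n (λ {a} _ → *-distribˡ-∑ n (δ₀ (position l a)) _) ⟩
  ∑ n (λ a → δ₀ (position l a) * ∑ n (λ b → δ₀ (position l b) * x))
    ≡⟨ ∑-cong n (λ {a} _ → cong (δ₀ (position l a) *_) (∑-position-δ₀ l m x)) ⟩
  ∑ n (λ a → δ₀ (position l a) * (suc m * x))
    ≡⟨ ∑-position-δ₀ l m (suc m * x) ⟩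
  suc m * (suc m * x) ∎
  where
  open ≡-Reasoning
  n : ℕ
  n = l + suc m

-- Walks and distances

T-does : ∀ {A : Set} (a? : Dec A) → A → T (does a?)
T-does a? a rewrite dec-true a? a = tt

T-does⇒ : ∀ {A : Set} (a? : Dec A) → T (does a?) → A
T-does⇒ (yes a) _ = a

anyFin-witness : ∀ {n} (p : Fin n → Bool) → T (anyFin p) → ∃[ w ] T (p w)
anyFin-witness {suc n} p t with Equivalence.to T-∨ t
... | inj₁ t₀ = fzero , t₀
... | inj₂ tₛ = let w , t-w = anyFin-witness (p ∘ fsuc) tₛ in fsuc w , t-w

anyFin-intro : ∀ {n} (p : Fin n → Bool) w → T (p w) → T (anyFin p)
anyFin-intro p fzero    t = Equivalence.from T-∨ (inj₁ t)
anyFin-intro p (fsuc w) t = Equivalence.from T-∨ (inj₂ (anyFin-intro (p ∘ fsuc) w t))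

search-≤ : ∀ (p : ℕ → Bool) b m → T (p m) → search p b ≤ m
search-≤ p zero    m       _ = z≤n
search-≤ p (suc b) m       t with p zero in p₀
... | true = z≤n
search-≤ p (suc b) zero    t | false = ⊥-elim (subst T p₀ t)
search-≤ p (suc b) (suc m) t | false = s≤s (search-≤ (p ∘ suc) b m t)

≤-search : ∀ (p : ℕ → Bool) b m → (∀ k → T (p k) → m ≤ k) → m ≤ b → m ≤ search p b
≤-search p zero    m       _  m≤0       = m≤0
≤-search p (suc b) zero    _  _         = z≤n
≤-search p (suc b) (suc m) lb (s≤s m≤b) with p zero in p₀
... | true  = lb 0 (subst T (sym p₀) tt)
... | false = s≤s (≤-search (p ∘ suc) b m (λ k t → ≤-pred (lb (suc k) t)) m≤b)

module _ {n} (G : Digraph n) where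

  reach-refl : ∀ u → T (reach G 0 u u)
  reach-refl u = T-does (u ≟F u) refl

  reach-snoc : ∀ {k} u w v → T (reach G k u w) → T (adj G w v) → T (reach G (suc k) u v)
  reach-snoc {k} u w v r a = Equivalence.from T-∨
    (inj₂ (anyFin-intro (λ x → reach G k u x ∧ adj G x v) w (Equivalence.from T-∧ (r , a))))

  reach-mono : ∀ {k m} u v → k ≤ m → T (reach G k u v) → T (reach G m u v)
  reach-mono u v k≤m = go (≤⇒≤′ k≤m)
    where
    go : ∀ {k m} → k ≤′ m → T (reach G k u v) → T (reach G m u v)
    go ≤′-refl          r = r
    go (≤′-step k≤′m) r = Equivalence.from T-∨ (inj₁ (go k≤′m r))

  reach⇒potential≤ : (δ : Fin n → ℕ) → ∀ {u} → δ u ≡ 0 → (∀ {w v} → T (adj G w v) → δ v ≤ suc (δ w)) →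
                     ∀ k {v} → T (reach G k u v) → δ v ≤ k
  reach⇒potential≤ δ {u} δu≡0 step zero {v} r with u ≟F v
  ... | yes refl = ≤-reflexive δu≡0
  reach⇒potential≤ δ {u} δu≡0 step (suc k) {v} r with Equivalence.to T-∨ r
  ... | inj₁ r′ = m≤n⇒m≤1+n (reach⇒potential≤ δ δu≡0 step k r′)
  ... | inj₂ r′ with anyFin-witness (λ x → reach G k u x ∧ adj G x v) r′
  ...   | w , r∧a with Equivalence.to T-∧ r∧a
  ...     | r-w , a = ≤-trans (step a) (s≤s (reach⇒potential≤ δ δu≡0 step k r-w))

  dist≤ : ∀ {k} u v → T (reach G k u v) → dist G u v ≤ k
  dist≤ {k} u v = search-≤ (λ j → reach G j u v) n k

  potential≤dist : (δ : Fin n → ℕ) → ∀ {u} → δ u ≡ 0 → (∀ {w v} → T (adj G w v) → δ v ≤ suc (δ w)) →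
                   ∀ v → δ v ≤ n → δ v ≤ dist G u v
  potential≤dist δ {u} δu≡0 step v = ≤-search (λ j → reach G j u v) n (δ v)
    (λ k → reach⇒potential≤ δ δu≡0 step k)

  sumFin²≡∑² : (h : ℕ → ℕ → ℕ) → sumFin {n} (λ u → sumFin {n} (λ v → h (toℕ u) (toℕ v))) ≡ ∑ n (λ a → ∑ n (h a))
  sumFin²≡∑² h = sumFin≡∑ {n} _ (λ a → ∑ n (h a)) (λ u → sumFin≡∑ {n} _ (h (toℕ u)) (λ v → refl))

  ∑²≤W : (h : ℕ → ℕ → ℕ) → (∀ u → h (toℕ u) (toℕ u) ≡ 0) →
         (∀ {u v} → u ≢ v → h (toℕ u) (toℕ v) ≤ dist G u v) → ∑ n (λ a → ∑ n (h a)) ≤ W G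
  ∑²≤W h diag off = ≤-trans (≤-reflexive (sym (sumFin²≡∑² h))) (sumFin-mono-≤ (λ u → sumFin-mono-≤ (term u)))
    where
    term : ∀ u v → h (toℕ u) (toℕ v) ≤ (if does (u ≟F v) then 0 else dist G u v)
    term u v with u ≟F v
    ... | yes refl = ≤-reflexive (diag u)
    ... | no u≢v   = off u≢v

  W≤∑² : (h : ℕ → ℕ → ℕ) → (∀ {u v} → u ≢ v → dist G u v ≤ h (toℕ u) (toℕ v)) → W G ≤ ∑ n (λ a → ∑ n (h a))
  W≤∑² h off = ≤-trans (sumFin-mono-≤ (λ u → sumFin-mono-≤ (term u))) (≤-reflexive (sumFin²≡∑² h))
    where
    term : ∀ u v → (if does (u ≟F v) then 0 else dist G u v) ≤ h (toℕ u) (toℕ v)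
    term u v with u ≟F v
    ... | yes _    = z≤n
    ... | no u≢v   = off u≢v

mask-arc : ∀ {n} (r : Fin n → Fin n → Bool) i j → i ≢ j → T (r i j) → T (adj (mask r) i j)
mask-arc r i j i≢j t rewrite dec-false (i ≟F j) i≢j = t

mask-arc⁻ : ∀ {n} (r : Fin n → Fin n → Bool) i j → T (adj (mask r) i j) → T (r i j)
mask-arc⁻ r i j t = proj₂ (Equivalence.to T-∧ t)

-- Digraphs lying over a cycle

module OnCycle {n} (G : Digraph n) (l : ℕ) (l<n : l < n) where

  L : ℕ
  L = suc l

  pos : Fin n → ℕ
  pos u = position l (toℕ u)

  pos<L : ∀ u → pos u < L
  pos<L u = position<1+l l (toℕ u)

  vertexAt : ∀ q → q < L → Fin n
  vertexAt zero    _         = fromℕ< l<n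
  vertexAt (suc i) (s≤s i<l) = fromℕ< (<-trans i<l l<n)

  pos-vertexAt : ∀ q (q<L : q < L) → pos (vertexAt q q<L) ≡ q
  pos-vertexAt zero    _         rewrite toℕ-fromℕ< l<n = position-≥ l ≤-refl
  pos-vertexAt (suc i) (s≤s i<l) rewrite toℕ-fromℕ< (<-trans i<l l<n) = position-< l i<l

  pos-injective : ∀ {u v} → pos u ≡ pos v → pos u ≡ 0 ⊎ u ≡ v
  pos-injective eq = map₂ toℕ-injective (position-injective l eq)

  HasCycleArcs : Set
  HasCycleArcs = ∀ w v → pos v ≡ cycSucc L (pos w) → T (adj G w v)

  ArcsFollowCycle : Set
  ArcsFollowCycle = ∀ w v → T (adj G w v) → pos v ≡ pos w ⊎ pos v ≡ cycSucc L (pos w)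

  reach-cycDist : HasCycleArcs → ∀ u v → pos u ≢ pos v → T (reach G (cycDist L (pos u) (pos v)) u v)
  reach-cycDist arcs u v pu≢pv with cycDist L (pos u) (pos v) in eq
  ... | zero  = contradiction (cycDist≡0⇒≡ (pos<L u) eq) pu≢pv
  ... | suc m = walk m eq
    where
    walk : ∀ m {x} → cycDist L (pos u) (pos x) ≡ suc m → T (reach G (suc m) u x)
    walk zero    {x} u→x = reach-snoc G {0} u u x (reach-refl G u) (arcs u x (cycDist≡1⇒cycSucc (pos<L u) (pos<L x) u→x))
    walk (suc m) {x} u→x = reach-snoc G {suc m} u w x (walk m u→w) (arcs w x w→x)
      where
      p<L : cycPred L (pos x) < L
      p<L = cycPred<L (pos<L x)
      w : Fin n
      w = vertexAt (cycPred L (pos x)) p<L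
      u→w : cycDist L (pos u) (pos w) ≡ suc m
      u→w rewrite pos-vertexAt _ p<L = cycDist-cycPred (pos<L u) (pos<L x) u→x
      w→x : pos x ≡ cycSucc L (pos w)
      w→x rewrite pos-vertexAt _ p<L = sym (cycSucc-cycPred (pos<L x))

  cycDist≤dist : ArcsFollowCycle → ∀ u v → cycDist L (pos u) (pos v) ≤ dist G u v
  cycDist≤dist follow u v = potential≤dist G (λ x → cycDist L (pos u) (pos x)) (cycDist-self (pos u)) step v
    (≤-trans (<⇒≤ (cycDist<L (pos<L u) (pos<L v))) l<n)
    where
    step : ∀ {w x} → T (adj G w x) → cycDist L (pos u) (pos x) ≤ suc (cycDist L (pos u) (pos w))
    step {w} {x} a with follow w x a
    ... | inj₁ same = ≤-trans (≤-reflexive (cong (cycDist L (pos u)) same)) (n≤1+n _)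
    ... | inj₂ next rewrite next = cycDist-cycSucc (pos<L u) (pos<L w)

  ∑²-cycDist≤W : ArcsFollowCycle → ∑ n (λ a → ∑ n (λ b → cycDist L (position l a) (position l b))) ≤ W G
  ∑²-cycDist≤W follow = ∑²≤W G (λ a b → cycDist L (position l a) (position l b))
    (λ u → cycDist-self (pos u)) (λ {u} {v} _ → cycDist≤dist follow u v)

  W≤∑²-cycDist+δ₀ : HasCycleArcs → (∀ u v → T (reach G L u v)) →
    W G ≤ ∑ n (λ a → ∑ n (λ b → cycDist L (position l a) (position l b)
                                  + δ₀ (position l a) * (δ₀ (position l b) * L)))
  W≤∑²-cycDist+δ₀ arcs reach-L = W≤∑² G _ bound
    where
    bound : ∀ {u v} → u ≢ v → dist G u v ≤ cycDist L (pos u) (pos v) + δ₀ (pos u) * (δ₀ (pos v) * L)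
    bound {u} {v} u≢v with pos u ≟ pos v
    ... | no pu≢pv = ≤-trans (dist≤ G u v (reach-cycDist arcs u v pu≢pv)) (m≤m+n (cycDist L (pos u) (pos v)) _)
    ... | yes pu≡pv with pos-injective pu≡pv
    ...   | inj₂ u≡v  = contradiction u≡v u≢v
    ...   | inj₁ pu≡0 = ≤-trans (dist≤ G u v (reach-L u v)) (≤-reflexive (sym (both0 pu≡0 (trans (sym pu≡pv) pu≡0))))
      where
      both0 : ∀ {p q} → p ≡ 0 → q ≡ 0 → cycDist L p q + δ₀ p * (δ₀ q * L) ≡ L
      both0 refl refl = trans (*-identityˡ _) (*-identityˡ L)

  module _ (0<l : 0 < l) (arcs : HasCycleArcs) (follow : ArcsFollowCycle)
           (clique : ∀ w v → w ≢ v → pos w ≡ 0 → pos v ≡ 0 → T (adj G w v)) where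

    reach-l : ∀ u v → T (reach G l u v)
    reach-l u v with u ≟F v
    ... | yes refl = reach-mono G u u (z≤n {l}) (reach-refl G u)
    ... | no u≢v with pos u ≟ pos v
    ...   | no pu≢pv = reach-mono G u v (≤-pred (cycDist<L (pos<L u) (pos<L v))) (reach-cycDist arcs u v pu≢pv)
    ...   | yes pu≡pv with pos-injective pu≡pv
    ...     | inj₂ u≡v  = contradiction u≡v u≢v
    ...     | inj₁ pu≡0 = reach-mono G u v 0<l
                            (reach-snoc G {0} u u v (reach-refl G u) (clique u v u≢v pu≡0 (trans (sym pu≡pv) pu≡0)))

    diameter : Diameter G l
    diameter = reach-l , u₀ , v₀ , ≤-antisym (≤-trans (dist≤ G u₀ v₀ (reach-cycDist arcs u₀ v₀ pu₀≢pv₀)) (≤-reflexive c₀))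
                                             (≤-trans (≤-reflexive (sym c₀)) (cycDist≤dist follow u₀ v₀))
      where
      1<L : 1 < L
      1<L = s≤s 0<l
      u₀ v₀ : Fin n
      u₀ = vertexAt 1 1<L
      v₀ = vertexAt 0 (s≤s z≤n)
      pu₀≢pv₀ : pos u₀ ≢ pos v₀
      pu₀≢pv₀ eq = contradiction (trans (sym (pos-vertexAt 1 1<L)) (trans eq (pos-vertexAt 0 (s≤s z≤n)))) (λ ())
      c₀ : cycDist L (pos u₀) (pos v₀) ≡ l
      c₀ rewrite pos-vertexAt 1 1<L | pos-vertexAt 0 (s≤s z≤n) = +-identityʳ l

-- The two competitors

-- blownUpCycle l m is the directed (l + 1)-cycle with its point 0 replaced by a complete
-- digraph on m vertices.
cycleOrCliqueArc : ∀ l {n} → Fin n → Fin n → Bool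
cycleOrCliqueArc l i j = does (position l (toℕ j) ≟ cycSucc (suc l) (position l (toℕ i))
                               ⊎-dec (position l (toℕ i) ≟ 0 ×-dec position l (toℕ j) ≟ 0))

blownUpCycle : ∀ l m → Digraph (l + m)
blownUpCycle l m = mask (cycleOrCliqueArc l)

module BlownUpCycle (l m : ℕ) (0<l : 0 < l) where

  G : Digraph (l + suc m)
  G = blownUpCycle l (suc m)

  open OnCycle G l (m<m+n l (s≤s z≤n))

  arc? : ∀ w v → Dec (pos v ≡ cycSucc L (pos w) ⊎ (pos w ≡ 0 × pos v ≡ 0))
  arc? w v = pos v ≟ cycSucc L (pos w) ⊎-dec (pos w ≟ 0 ×-dec pos v ≟ 0)

  cycleArcs : HasCycleArcs
  cycleArcs w v eq = mask-arc (cycleOrCliqueArc l) w v w≢v (T-does (arc? w v) (inj₁ eq))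
    where
    w≢v : w ≢ v
    w≢v refl = cycSucc≢ (s≤s 0<l) (pos w) (sym eq)

  cliqueArcs : ∀ w v → w ≢ v → pos w ≡ 0 → pos v ≡ 0 → T (adj G w v)
  cliqueArcs w v w≢v pw≡0 pv≡0 = mask-arc (cycleOrCliqueArc l) w v w≢v (T-does (arc? w v) (inj₂ (pw≡0 , pv≡0)))

  followsCycle : ArcsFollowCycle
  followsCycle w v a with T-does⇒ (arc? w v) (mask-arc⁻ (cycleOrCliqueArc l) w v a)
  ... | inj₁ next          = inj₂ next
  ... | inj₂ (pw≡0 , pv≡0) = inj₁ (trans pv≡0 (sym pw≡0))

  diameter-l : Diameter G l
  diameter-l = diameter 0<l cycleArcs followsCycle cliqueArcs

  W-≥ : (suc l + 2 * m) * cycRow (suc l) ≤ W G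
  W-≥ = ≤-trans (≤-reflexive (sym (∑²-position-cycDist l m))) (∑²-cycDist≤W followsCycle)

-- The arc relation of Dnd n (2 + e), read on vertex indices (definitionally equal to it).
Dnd-arc? : ∀ e a b → Dec ((b ≡ suc a × b ≤ e) ⊎ (a ≡ e × suc e ≤ b) ⊎ (suc e ≤ a × b ≡ 0))
Dnd-arc? e a b = (b ≟ suc a ×-dec b ≤? e) ⊎-dec (a ≟ e ×-dec suc e ≤? b) ⊎-dec (suc e ≤? a ×-dec b ≟ 0)

Dnd-cycleArc : ∀ e {a b} → position (suc e) b ≡ cycSucc (2 + e) (position (suc e) a) → T (does (Dnd-arc? e a b))
Dnd-cycleArc e {a} {b} eq = T-does (Dnd-arc? e a b) arc
  where
  arc : (b ≡ suc a × b ≤ e) ⊎ (a ≡ e × suc e ≤ b) ⊎ (suc e ≤ a × b ≡ 0)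
  arc with a <? suc e
  ... | no a≮1+e = inj₂ (inj₂ (≮⇒≥ a≮1+e , position≡suc⇒≡ (suc e) (trans eq
          (trans (cong (cycSucc (2 + e)) (position-≥ (suc e) (≮⇒≥ a≮1+e))) (cycSucc-< {2 + e} (s≤s (s≤s z≤n)))))))
  ... | yes a<1+e with suc (suc a) <? 2 + e
  ...   | yes a<e = inj₁ (b≡1+a , subst (_≤ e) (sym b≡1+a) (≤-pred (≤-pred a<e)))
    where
    b≡1+a : b ≡ suc a
    b≡1+a = position≡suc⇒≡ (suc e) (trans eq (trans (cong (cycSucc (2 + e)) (position-< (suc e) a<1+e)) (cycSucc-< a<e)))
  ...   | no a≮e = inj₂ (inj₁ (≤-antisym (≤-pred a<1+e) (≤-pred (≤-pred (≮⇒≥ a≮e))) ,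
          position≡0⇒≥ (suc e) (trans eq (trans (cong (cycSucc (2 + e)) (position-< (suc e) a<1+e)) (cycSucc-≮ a≮e)))))

module DndOnCycle (e k : ℕ) where

  D : Digraph (2 + e + k)
  D = Dnd (2 + e + k) (2 + e)

  open OnCycle D (suc e) (m≤m+n (2 + e) k)

  cycleArcs : HasCycleArcs
  cycleArcs w v eq with w ≟F v
  ... | yes refl = contradiction (sym eq) (cycSucc≢ (s≤s (s≤s z≤n)) (pos w))
  ... | no _     = Dnd-cycleArc e eq

  W-≤ : (∀ u v → T (reach D (2 + e) u v)) → W D ≤ (2 + e + 2 * k) * cycRow (2 + e) + suc k * (suc k * (2 + e))
  W-≤ reach-d = begin
    W D
      ≤⟨ W≤∑²-cycDist+δ₀ cycleArcs reach-d ⟩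
    ∑ (2 + e + k) (λ a → ∑ (2 + e + k) (λ b → f a b + g a b))
      ≡⟨ cong (λ n → ∑ n (λ a → ∑ n (λ b → f a b + g a b))) (sym (+-suc (suc e) k)) ⟩
    ∑ n (λ a → ∑ n (λ b → f a b + g a b))
      ≡⟨ ∑²-distrib-+ n f g ⟩
    ∑ n (λ a → ∑ n (f a)) + ∑ n (λ a → ∑ n (g a))
      ≡⟨ cong₂ _+_ (∑²-position-cycDist (suc e) k) (∑²-position-δ₀ (suc e) k (2 + e)) ⟩
    (2 + e + 2 * k) * cycRow (2 + e) + suc k * (suc k * (2 + e)) ∎
    where
    open ≤-Reasoning
    n : ℕ
    n = suc e + suc k
    f g : ℕ → ℕ → ℕ
    f a b = cycDist (2 + e) (position (suc e) a) (position (suc e) b)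
    g a b = δ₀ (position (suc e) a) * (δ₀ (position (suc e) b) * (2 + e))

-- For d = e + 2 and k = k' + 1, twice the right side minus twice the left is d (2k² + 3 − d).
wienerGap⇒bound : ∀ e k' →
  (3 + e + 2 * k') * cycRow (3 + e) ≤ (2 + e + 2 * suc k') * cycRow (2 + e) + suc (suc k') * (suc (suc k') * (2 + e)) →
  2 + e ≤ 2 * (suc k' * suc k') + 3
wienerGap⇒bound e k' gap = +-cancelʳ-≤ (3 + 4 * k') _ _ (+-cancelˡ-≤ (B * (1 + e)) _ _ (begin
  B * (1 + e) + ((2 + e) + (3 + 4 * k'))
    ≡⟨ solve 2 (λ e k → (con 2 :+ e :+ con 2 :* (con 1 :+ k)) :* (con 1 :+ e) :+ ((con 2 :+ e) :+ (con 3 :+ con 4 :* k))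
                      := (con 3 :+ e :+ con 2 :* k) :* (con 3 :+ e)) refl e k' ⟩
  A * (3 + e)
    ≤⟨ *-cancelˡ-≤ (2 + e) scaled ⟩
  B * (1 + e) + 2 * (K * K)
    ≡⟨ cong (B * (1 + e) +_) (solve 1 (λ k → con 2 :* ((con 2 :+ k) :* (con 2 :+ k))
                                          := (con 2 :* ((con 1 :+ k) :* (con 1 :+ k)) :+ con 3) :+ (con 3 :+ con 4 :* k)) refl k') ⟩
  B * (1 + e) + ((2 * (suc k' * suc k') + 3) + (3 + 4 * k')) ∎))
  where
  open ≤-Reasoning
  A B K : ℕ
  A = 3 + e + 2 * k'
  B = 2 + e + 2 * suc k'
  K = suc (suc k')
  scaled : (2 + e) * (A * (3 + e)) ≤ (2 + e) * (B * (1 + e) + 2 * (K * K))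
  scaled = begin
    (2 + e) * (A * (3 + e))
      ≡⟨ solve 2 (λ a e → (con 2 :+ e) :* (a :* (con 3 :+ e)) := a :* ((con 2 :+ e) :* (con 3 :+ e))) refl A e ⟩
    A * ((2 + e) * (3 + e))
      ≡⟨ cong (A *_) (sym (cycRow-double (2 + e))) ⟩
    A * (2 * cycRow (3 + e))
      ≡⟨ solve 2 (λ a r → a :* (con 2 :* r) := con 2 :* (a :* r)) refl A (cycRow (3 + e)) ⟩
    2 * (A * cycRow (3 + e))
      ≤⟨ *-monoʳ-≤ 2 gap ⟩
    2 * (B * cycRow (2 + e) + K * (K * (2 + e)))
      ≡⟨ solve 3 (λ b r z → con 2 :* (b :* r :+ z) := b :* (con 2 :* r) :+ con 2 :* z) refl B (cycRow (2 + e)) _ ⟩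
    B * (2 * cycRow (2 + e)) + 2 * (K * (K * (2 + e)))
      ≡⟨ cong (λ x → B * x + 2 * (K * (K * (2 + e)))) (cycRow-double (1 + e)) ⟩
    B * ((1 + e) * (2 + e)) + 2 * (K * (K * (2 + e)))
      ≡⟨ solve 3 (λ b k e → b :* ((con 1 :+ e) :* (con 2 :+ e)) :+ con 2 :* (k :* (k :* (con 2 :+ e)))
                          := (con 2 :+ e) :* (b :* (con 1 :+ e) :+ con 2 :* (k :* k))) refl B K e ⟩
    (2 + e) * (B * (1 + e) + 2 * (K * K)) ∎

uniqueMax⇒bound-suc : ∀ e k' → UniqueMax (2 + e + suc k') (2 + e) → 2 + e ≤ 2 * (suc k' * suc k') + 3
uniqueMax⇒bound-suc e k' (_ , (reach-D , _) , maximal) = wienerGap⇒bound e k' (begin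
  (3 + e + 2 * k') * cycRow (3 + e)   ≤⟨ BlownUpCycle.W-≥ (2 + e) k' 0<d ⟩
  W G                                 ≤⟨ proj₁ (maximal G (BlownUpCycle.diameter-l (2 + e) k' 0<d)) ⟩
  W (Dnd (2 + e + suc k') (2 + e))    ≤⟨ DndOnCycle.W-≤ e (suc k') reach-D ⟩
  (2 + e + 2 * suc k') * cycRow (2 + e) + suc (suc k') * (suc (suc k') * (2 + e)) ∎)
  where
  open ≤-Reasoning
  0<d : 0 < 2 + e
  0<d = s≤s z≤n
  G : Digraph (2 + e + suc k')
  G = blownUpCycle (2 + e) (suc k')

uniqueMax⇒bound : ∀ {n d} → 2 ≤ d → UniqueMax n d → d ≤ 2 * ((n ∸ d) * (n ∸ d)) + 3
uniqueMax⇒bound {n} {d@(suc (suc e))} (s≤s (s≤s _)) unique@(d<n , _) with n ∸ d in n∸d≡k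
... | zero   = contradiction (m∸n≡0⇒m≤n n∸d≡k) (<⇒≱ d<n)
... | suc k' = uniqueMax⇒bound-suc e k' (subst (λ m → UniqueMax m d) n≡d+k unique)
  where
  n≡d+k : n ≡ d + suc k'
  n≡d+k = trans (sym (m+[n∸m]≡n (<⇒≤ d<n))) (cong (d +_) n∸d≡k)

2*x+3≤9*x : ∀ {x} → 1 ≤ x → 2 * x + 3 ≤ 3 * 3 * x
2*x+3≤9*x {suc y} _ = ≤-trans (m≤m+n (2 * suc y + 3) (7 * y + 4))
  (≤-reflexive (solve 1 (λ y → (con 2 :* (con 1 :+ y) :+ con 3) :+ (con 7 :* y :+ con 4)
                             := con 3 :* con 3 :* (con 1 :+ y)) refl y))

proposition6p1 : ∃[ p ] ∃[ q ] (1 ≤ p × 1 ≤ q × ∃[ d₀ ] (∀ (d : ℕ) → 2 ≤ d → d₀ ≤ d →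
                   ∀ (N : ℕ) → (∀ (n : ℕ) → N ≤ n → UniqueMax n d) →
                   d ≤ N × p * p * d ≤ q * q * ((N ∸ d) * (N ∸ d))))
proposition6p1 = 1 , 3 , s≤s z≤n , s≤s z≤n , 2 , threshold
  where
  threshold : ∀ d → 2 ≤ d → 2 ≤ d → ∀ N → (∀ n → N ≤ n → UniqueMax n d) →
              d ≤ N × 1 * 1 * d ≤ 3 * 3 * ((N ∸ d) * (N ∸ d))
  threshold d 2≤d _ N unique = <⇒≤ d<N , (begin
    1 * 1 * d        ≡⟨ *-identityˡ d ⟩
    d                ≤⟨ uniqueMax⇒bound 2≤d (unique N ≤-refl) ⟩
    2 * (k * k) + 3  ≤⟨ 2*x+3≤9*x (*-mono-≤ 0<k 0<k) ⟩
    3 * 3 * (k * k)  ∎)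
    where
    open ≤-Reasoning
    d<N : d < N
    d<N = proj₁ (unique N ≤-refl)
    k : ℕ
    k = N ∸ d
    0<k : 0 < k
    0<k = m<n⇒0<n∸m d<N
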